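{- Let $s,t_1,\ldots,t_m$ be nonnegative integers, set $\mathbf{x}=(x_1,\ldots,x_m)$ and $\mathbf{t}=(t_1,\ldots,t_m)$, and let $f(\mathbf{x})\in\mathbb{Q}[x_1,\ldots,x_m]$ be a homogeneous polynomial of total degree $t_1+\cdots+t_m-s$. Then $$\Big[\frac{\mathbf{x}^{\mathbf{t}}}{\mathbf{t}!}\Big]\,(x_1+\cdots+x_m)^s f(\mathbf{x}) = s!\,\mathfrak{D}\big(f(\mathbf{x})\big)\Big|_{x_1=t_1,\ldots,x_m=t_m}.$$
   Context: $\mathbf{x}^{\mathbf{t}}=x_1^{t_1}\cdots x_m^{t_m}$ and $\mathbf{t}!=t_1!\cdots t_m!$; $[\mathbf{x}^{\mathbf{t}}/\mathbf{t}!]\,g$ denotes the coefficient of the monomial $\mathbf{x}^{\mathbf{t}}/\mathbf{t}!$ in $g$ (i.e. $\mathbf{t}!$ times the coefficient of $\mathbf{x}^{\mathbf{t}}$). $\mathfrak{D}$ is the linear operator on $\mathbb{Q}[[x_1,\ldots,x_m]]$ defined by $\mathfrak{D}(x_i^j)=x_i(x_i-1)\cdots(x_i-j+1)$ for each $i$ and $j\geq 0$, extended multiplicatively to monomials $x_1^{j_1}\cdots x_m^{j_m}$ (i.e. $\mathfrak{D}(x_1^{j_1}\cdots x_m^{j_m})=\prod_i \mathfrak{D}(x_i^{j_i})$) and then linearly. -}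

module Defs where

open import Data.Nat as ℕ using (ℕ; zero; suc; _∸_; _!; _≟_)
open import Data.Integer using (+_)
open import Data.Rational using (ℚ; 0ℚ; 1ℚ; _/_; _+_; _*_)
open import Data.Fin using (Fin; zero; suc)
open import Data.Vec using (Vec; []; _∷_; lookup; tabulate; zipWith; foldr)
open import Data.Vec.Properties using (≡-dec)
open import Data.List using (List; []; _∷_; map; concatMap; allFin)
open import Data.Product using (_×_; _,_; proj₁; proj₂)
open import Relation.Nullary using (yes; no)
open import Relation.Binary.PropositionalEquality using (_≡_)

ℕ→ℚ : ℕ → ℚ
ℕ→ℚ n = + n / 1

-- exponent vectors and polynomials in m variables over ℚ, represented as
-- finite lists of terms (coefficient , exponent vector); the polynomial
-- denoted is the sum of the terms (repetitions allowed).
Exp : ℕ → Set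
Exp m = Vec ℕ m

Term : ℕ → Set
Term m = ℚ × Exp m

Poly : ℕ → Set
Poly m = List (Term m)

degE : ∀ {m} → Exp m → ℕ
degE = foldr (λ _ → ℕ) ℕ._+_ 0

vecFact : ∀ {m} → Exp m → ℕ
vecFact = foldr (λ _ → ℕ) (λ a b → (a !) ℕ.* b) 1

_·_ : ∀ {m} → Poly m → Poly m → Poly m
p · q = concatMap (λ a → map (λ b → (proj₁ a * proj₁ b , zipWith ℕ._+_ (proj₂ a) (proj₂ b))) q) p

oneP : ∀ {m} → Poly m
oneP {m} = (1ℚ , tabulate (λ _ → 0)) ∷ []

_^P_ : ∀ {m} → Poly m → ℕ → Poly m
p ^P zero = oneP
p ^P suc n = p · (p ^P n)

unitE : ∀ {m} → Fin m → Exp m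
unitE {suc m} zero = 1 ∷ tabulate (λ _ → 0)
unitE {suc m} (suc i) = 0 ∷ unitE i

sumVars : ∀ m → Poly m
sumVars m = map (λ i → (1ℚ , unitE i)) (allFin m)

coeff : ∀ {m} → Exp m → Poly m → ℚ
coeff t [] = 0ℚ
coeff t ((c , e) ∷ g) with ≡-dec _≟_ e t
... | yes _ = c + coeff t g
... | no  _ = coeff t g

-- [x^t / t!] g  =  t! · (coefficient of x^t in g)
coeffDiv : ∀ {m} → Exp m → Poly m → ℚ
coeffDiv t g = ℕ→ℚ (vecFact t) * coeff t g

falling : ℕ → ℕ → ℕ
falling a zero = 1
falling a (suc j) = a ℕ.* falling (a ∸ 1) j

-- 𝔇 applied to a monomial x^e and evaluated at x = t
evalDMon : ∀ {m} → Exp m → Exp m → ℕ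
evalDMon [] [] = 1
evalDMon (j ∷ e) (a ∷ t) = falling a j ℕ.* evalDMon e t

evalD : ∀ {m} → Poly m → Exp m → ℚ
evalD [] t = 0ℚ
evalD ((c , e) ∷ f) t = c * ℕ→ℚ (evalDMon e t) + evalD f t

-- Induction on s; both sides are linear in f, so each step is checked term by term.
-- For s = 0 a term c x^e of degree |t| contributes t! c [e = t] on the left and
-- c 𝔇(x^e)(t) on the right.  These agree because 𝔇(x^e)(t) = ∏ᵢ tᵢ(tᵢ-1)⋯(tᵢ-eᵢ+1)
-- vanishes unless e ≤ t componentwise, which for equal degrees forces e = t, and
-- 𝔇(x^t)(t) = t!.  For the step, (x₁+⋯+x_m)^(s+1) f = (x₁+⋯+x_m)^s g with
-- g = (x₁+⋯+x_m) f homogeneous of degree |t| - s, and 𝔇(xᵢ x^e)(t) = 𝔇(x^e)(t) (tᵢ - eᵢ);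
-- summing over i gives (|t| - |e|) 𝔇(x^e)(t) = (s+1) 𝔇(x^e)(t), hence 𝔇(g)(t) =
-- (s+1) 𝔇(f)(t).  Truncated subtraction tᵢ ∸ eᵢ is harmless here because
-- 𝔇(x^e)(t) = 0 whenever some eᵢ > tᵢ.
module Submission where

open import Defs
open import Data.Nat using (ℕ; _!; _+_)
open import Data.Rational using (ℚ; 0ℚ; _*_)
open import Data.Product using (proj₁; proj₂)
open import Data.List.Relation.Unary.All using (All)
open import Relation.Nullary using (¬_)
open import Relation.Binary.PropositionalEquality using (_≡_)

open import Function using (_∘_)
open import Data.Nat as ℕ using (zero; suc; _∸_; _≤_; _<_; s≤s)
import Data.Nat.Properties as ℕₚ
open import Data.Nat.Coprimality using (1-coprimeTo)
import Data.Nat.Coprimality as Coprime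
open import Data.Nat.Solver using (module +-*-Solver)
open import Data.Integer as ℤ using (+_; 1ℤ)
import Data.Integer.Properties as ℤₚ
open import Data.Rational as ℚ using (1ℚ; toℚᵘ)
import Data.Rational.Properties as ℚₚ
open import Algebra.Bundles using (CommutativeMonoid)
open import Algebra.Properties.CommutativeSemigroup
  (CommutativeMonoid.commutativeSemigroup ℚₚ.+-0-commutativeMonoid)
  using () renaming (interchange to +-interchange)
open import Data.Rational.Unnormalised as ℚᵘ using (mkℚᵘ; *≡*)
import Data.Rational.Unnormalised.Properties as ℚᵘₚ
open import Data.Fin using (Fin) renaming (zero to fzero; suc to fsuc)
open import Data.Vec using (Vec; []; _∷_; zipWith; tabulate; lookup)
open import Data.Vec.Properties using (≡-dec)
open import Data.Vec.Relation.Binary.Pointwise.Inductive using (Pointwise; []; _∷_)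
open import Data.List using (List; []; _∷_; _++_; map; concatMap; allFin)
  renaming (tabulate to tabulateₗ)
open import Data.List.Properties using (map-tabulate)
import Data.List.Relation.Unary.All as All
open import Data.List.Relation.Unary.All using ([]; _∷_)
open import Data.List.Relation.Unary.All.Properties using (++⁺; map⁺; tabulate⁺)
open import Data.Product using (_,_)
open import Data.Empty using (⊥-elim)
open import Relation.Nullary using (yes; no)
open import Relation.Binary.PropositionalEquality
  using (refl; sym; trans; cong; cong₂; module ≡-Reasoning)

ℕ→ℚ-toℚᵘ : ∀ n → toℚᵘ (ℕ→ℚ n) ≡ mkℚᵘ (+ n) 0
ℕ→ℚ-toℚᵘ n = cong toℚᵘ (ℚₚ.normalize-coprime (Coprime.sym (1-coprimeTo n)))

ℕ→ℚ-+ : ∀ a b → ℕ→ℚ (a + b) ≡ ℕ→ℚ a ℚ.+ ℕ→ℚ b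
ℕ→ℚ-+ a b = ℚₚ.toℚᵘ-injective (begin
  toℚᵘ (ℕ→ℚ (a + b))
    ≡⟨ ℕ→ℚ-toℚᵘ (a + b) ⟩
  mkℚᵘ (+ (a + b)) 0
    ≈⟨ *≡* (cong (ℤ._* 1ℤ) (trans (ℤₚ.pos-+ a b)
         (sym (cong₂ ℤ._+_ (ℤₚ.*-identityʳ (+ a)) (ℤₚ.*-identityʳ (+ b)))))) ⟩
  mkℚᵘ (+ a) 0 ℚᵘ.+ mkℚᵘ (+ b) 0
    ≡⟨ sym (cong₂ ℚᵘ._+_ (ℕ→ℚ-toℚᵘ a) (ℕ→ℚ-toℚᵘ b)) ⟩
  toℚᵘ (ℕ→ℚ a) ℚᵘ.+ toℚᵘ (ℕ→ℚ b)
    ≈⟨ ℚᵘₚ.≃-sym (ℚₚ.toℚᵘ-homo-+ (ℕ→ℚ a) (ℕ→ℚ b)) ⟩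
  toℚᵘ (ℕ→ℚ a ℚ.+ ℕ→ℚ b) ∎)
  where open ℚᵘₚ.≃-Reasoning

ℕ→ℚ-* : ∀ a b → ℕ→ℚ (a ℕ.* b) ≡ ℕ→ℚ a * ℕ→ℚ b
ℕ→ℚ-* a b = ℚₚ.toℚᵘ-injective (begin
  toℚᵘ (ℕ→ℚ (a ℕ.* b))
    ≡⟨ ℕ→ℚ-toℚᵘ (a ℕ.* b) ⟩
  mkℚᵘ (+ (a ℕ.* b)) 0
    ≈⟨ *≡* (cong (ℤ._* 1ℤ) (ℤₚ.pos-* a b)) ⟩
  mkℚᵘ (+ a) 0 ℚᵘ.* mkℚᵘ (+ b) 0
    ≡⟨ sym (cong₂ ℚᵘ._*_ (ℕ→ℚ-toℚᵘ a) (ℕ→ℚ-toℚᵘ b)) ⟩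
  toℚᵘ (ℕ→ℚ a) ℚᵘ.* toℚᵘ (ℕ→ℚ b)
    ≈⟨ ℚᵘₚ.≃-sym (ℚₚ.toℚᵘ-homo-* (ℕ→ℚ a) (ℕ→ℚ b)) ⟩
  toℚᵘ (ℕ→ℚ a * ℕ→ℚ b) ∎)
  where open ℚᵘₚ.≃-Reasoning

*-congˡ-unless-zero : ∀ {c x y} → (¬ c ≡ 0ℚ → x ≡ y) → c * x ≡ c * y
*-congˡ-unless-zero {c} {x} {y} eq with c ℚₚ.≟ 0ℚ
... | yes refl = trans (ℚₚ.*-zeroˡ x) (sym (ℚₚ.*-zeroˡ y))
... | no c≢0   = cong (c *_) (eq c≢0)

private variable A B : Set

∑ : List A → (A → ℚ) → ℚ
∑ []       g = 0ℚ
∑ (x ∷ xs) g = g x ℚ.+ ∑ xs g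

syntax ∑ xs (λ x → e) = ∑[ x ∈ xs ] e

∑-cong : ∀ (xs : List A) {g h : A → ℚ} → (∀ x → g x ≡ h x) → ∑ xs g ≡ ∑ xs h
∑-cong []       eq = refl
∑-cong (x ∷ xs) eq = cong₂ ℚ._+_ (eq x) (∑-cong xs eq)

∑-congᴬˡˡ : ∀ {P : A → Set} {xs} {g h : A → ℚ} →
            All P xs → (∀ {x} → P x → g x ≡ h x) → ∑ xs g ≡ ∑ xs h
∑-congᴬˡˡ []         eq = refl
∑-congᴬˡˡ (px ∷ pxs) eq = cong₂ ℚ._+_ (eq px) (∑-congᴬˡˡ pxs eq)

∑-zero : ∀ (xs : List A) → ∑[ x ∈ xs ] 0ℚ ≡ 0ℚ
∑-zero []       = refl
∑-zero (x ∷ xs) = trans (ℚₚ.+-identityˡ _) (∑-zero xs)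

∑-++ : ∀ (xs ys : List A) (g : A → ℚ) → ∑ (xs ++ ys) g ≡ ∑ xs g ℚ.+ ∑ ys g
∑-++ []       ys g = sym (ℚₚ.+-identityˡ (∑ ys g))
∑-++ (x ∷ xs) ys g =
  trans (cong (g x ℚ.+_) (∑-++ xs ys g)) (sym (ℚₚ.+-assoc (g x) (∑ xs g) (∑ ys g)))

∑-+ : ∀ xs (g h : A → ℚ) → ∑[ x ∈ xs ] (g x ℚ.+ h x) ≡ ∑ xs g ℚ.+ ∑ xs h
∑-+ []       g h = refl
∑-+ (x ∷ xs) g h = trans (cong (g x ℚ.+ h x ℚ.+_) (∑-+ xs g h))
                         (+-interchange (g x) (h x) (∑ xs g) (∑ xs h))

∑-distribˡ : ∀ c xs (g : A → ℚ) → c * ∑ xs g ≡ ∑[ x ∈ xs ] (c * g x)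
∑-distribˡ c []       g = ℚₚ.*-zeroʳ c
∑-distribˡ c (x ∷ xs) g =
  trans (ℚₚ.*-distribˡ-+ c (g x) (∑ xs g)) (cong (c * g x ℚ.+_) (∑-distribˡ c xs g))

∑-map : (h : B → A) (xs : List B) (g : A → ℚ) → ∑ (map h xs) g ≡ ∑ xs (g ∘ h)
∑-map h []       g = refl
∑-map h (x ∷ xs) g = cong (g (h x) ℚ.+_) (∑-map h xs g)

∑-concatMap : (h : B → List A) (xs : List B) (g : A → ℚ) →
              ∑ (concatMap h xs) g ≡ ∑[ x ∈ xs ] ∑ (h x) g
∑-concatMap h []       g = refl
∑-concatMap h (x ∷ xs) g =
  trans (∑-++ (h x) (concatMap h xs) g) (cong (∑ (h x) g ℚ.+_) (∑-concatMap h xs g))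

∑-comm : (xs : List A) (ys : List B) (h : A → B → ℚ) →
         ∑[ x ∈ xs ] ∑[ y ∈ ys ] h x y ≡ ∑[ y ∈ ys ] ∑[ x ∈ xs ] h x y
∑-comm []       ys h = sym (∑-zero ys)
∑-comm (x ∷ xs) ys h = trans (cong (∑ ys (h x) ℚ.+_) (∑-comm xs ys h))
                             (sym (∑-+ ys (h x) (λ y → ∑[ x′ ∈ xs ] h x′ y)))

∑-allFin-suc : ∀ n (g : Fin (suc n) → ℚ) →
               ∑ (allFin (suc n)) g ≡ g fzero ℚ.+ ∑ (allFin n) (g ∘ fsuc)
∑-allFin-suc n g = cong (g fzero ℚ.+_) (begin
  ∑ (tabulateₗ fsuc) g       ≡⟨ cong (λ xs → ∑ xs g) (sym (map-tabulate (λ i → i) fsuc)) ⟩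
  ∑ (map fsuc (allFin n)) g  ≡⟨ ∑-map fsuc (allFin n) g ⟩
  ∑ (allFin n) (g ∘ fsuc)    ∎)
  where open ≡-Reasoning

_·ₜ_ : ∀ {m} → Term m → Term m → Term m
a ·ₜ b = (proj₁ a * proj₁ b , zipWith _+_ (proj₂ a) (proj₂ b))

∑-· : ∀ {m} (p q : Poly m) (φ : Term m → ℚ) →
      ∑ (p · q) φ ≡ ∑[ a ∈ p ] ∑[ b ∈ q ] φ (a ·ₜ b)
∑-· p q φ =
  trans (∑-concatMap (λ a → map (a ·ₜ_) q) p φ) (∑-cong p (λ a → ∑-map (a ·ₜ_) q φ))

zipWith-+-leftComm : ∀ {m} (x y z : Vec ℕ m) →
                     zipWith _+_ (zipWith _+_ x y) z ≡ zipWith _+_ y (zipWith _+_ x z)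
zipWith-+-leftComm []       []       []       = refl
zipWith-+-leftComm (x ∷ xs) (y ∷ ys) (z ∷ zs) =
  cong₂ _∷_ (trans (cong (_+ z) (ℕₚ.+-comm x y)) (ℕₚ.+-assoc y x z))
            (zipWith-+-leftComm xs ys zs)

zipWith-+-identityˡ : ∀ {m} (e : Vec ℕ m) → zipWith _+_ (tabulate (λ _ → 0)) e ≡ e
zipWith-+-identityˡ []      = refl
zipWith-+-identityˡ (x ∷ e) = cong (x ∷_) (zipWith-+-identityˡ e)

·ₜ-leftComm : ∀ {m} (a b c : Term m) → (a ·ₜ b) ·ₜ c ≡ b ·ₜ (a ·ₜ c)
·ₜ-leftComm (ca , ea) (cb , eb) (cc , ec) =
  cong₂ _,_ (trans (cong (_* cc) (ℚₚ.*-comm ca cb)) (ℚₚ.*-assoc cb ca cc))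
            (zipWith-+-leftComm ea eb ec)

∑-·-leftComm : ∀ {m} (p q f : Poly m) (φ : Term m → ℚ) →
               ∑ ((p · q) · f) φ ≡ ∑ (q · (p · f)) φ
∑-·-leftComm p q f φ = begin
  ∑ ((p · q) · f) φ
    ≡⟨ ∑-· (p · q) f φ ⟩
  ∑[ x ∈ p · q ] ∑[ c ∈ f ] φ (x ·ₜ c)
    ≡⟨ ∑-· p q _ ⟩
  ∑[ a ∈ p ] ∑[ b ∈ q ] ∑[ c ∈ f ] φ ((a ·ₜ b) ·ₜ c)
    ≡⟨ ∑-cong p (λ a → ∑-cong q (λ b → ∑-cong f (λ c → cong φ (·ₜ-leftComm a b c)))) ⟩
  ∑[ a ∈ p ] ∑[ b ∈ q ] ∑[ c ∈ f ] φ (b ·ₜ (a ·ₜ c))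
    ≡⟨ ∑-comm p q _ ⟩
  ∑[ b ∈ q ] ∑[ a ∈ p ] ∑[ c ∈ f ] φ (b ·ₜ (a ·ₜ c))
    ≡⟨ ∑-cong q (λ b → sym (∑-· p f (λ y → φ (b ·ₜ y)))) ⟩
  ∑[ b ∈ q ] ∑[ y ∈ p · f ] φ (b ·ₜ y)
    ≡⟨ sym (∑-· q (p · f) φ) ⟩
  ∑ (q · (p · f)) φ ∎
  where open ≡-Reasoning

∑-oneP-· : ∀ {m} (f : Poly m) (φ : Term m → ℚ) → ∑ (oneP · f) φ ≡ ∑ f φ
∑-oneP-· f φ = trans (∑-· oneP f φ) (trans (ℚₚ.+-identityʳ _)
  (∑-cong f (λ (c , e) → cong φ (cong₂ _,_ (ℚₚ.*-identityˡ c) (zipWith-+-identityˡ e)))))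

coefficientOf : ∀ {m} → Exp m → Term m → ℚ
coefficientOf t (c , e) with ≡-dec ℕ._≟_ e t
... | yes _ = c
... | no  _ = 0ℚ

coeff-∑ : ∀ {m} (t : Exp m) (g : Poly m) → coeff t g ≡ ∑ g (coefficientOf t)
coeff-∑ t []            = refl
coeff-∑ t ((c , e) ∷ g) with ≡-dec ℕ._≟_ e t
... | yes _ = cong (c ℚ.+_) (coeff-∑ t g)
... | no  _ = trans (coeff-∑ t g) (sym (ℚₚ.+-identityˡ _))

∑-cong⇒coeffDiv-cong : ∀ {m} (t : Exp m) (p q : Poly m) →
                       (∀ φ → ∑ p φ ≡ ∑ q φ) → coeffDiv t p ≡ coeffDiv t q
∑-cong⇒coeffDiv-cong t p q eq =
  cong (ℕ→ℚ (vecFact t) *_)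
       (trans (coeff-∑ t p) (trans (eq (coefficientOf t)) (sym (coeff-∑ t q))))

evalDTerm : ∀ {m} → Exp m → Term m → ℚ
evalDTerm t (c , e) = c * ℕ→ℚ (evalDMon e t)

evalD-∑ : ∀ {m} (f : Poly m) (t : Exp m) → evalD f t ≡ ∑ f (evalDTerm t)
evalD-∑ []            t = refl
evalD-∑ ((c , e) ∷ f) t = cong (evalDTerm t (c , e) ℚ.+_) (evalD-∑ f t)

falling-suc : ∀ a j → falling a (suc j) ≡ falling a j ℕ.* (a ∸ j)
falling-suc a       zero    = trans (ℕₚ.*-identityʳ a) (sym (ℕₚ.*-identityˡ a))
falling-suc zero    (suc j) = refl
falling-suc (suc a) (suc j) =
  trans (cong (suc a ℕ.*_) (falling-suc a j)) (sym (ℕₚ.*-assoc (suc a) (falling a j) (a ∸ j)))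

falling-< : ∀ {a j} → a < j → falling a j ≡ 0
falling-< {zero}  {suc j} _         = refl
falling-< {suc a} {suc j} (s≤s a<j) =
  trans (cong (suc a ℕ.*_) (falling-< a<j)) (ℕₚ.*-zeroʳ (suc a))

falling≢0⇒≤ : ∀ {a j} → ¬ falling a j ≡ 0 → j ≤ a
falling≢0⇒≤ falling≢0 = ℕₚ.≮⇒≥ (falling≢0 ∘ falling-<)

falling-*-∸+ : ∀ a j → falling a j ℕ.* (a ∸ j + j) ≡ falling a j ℕ.* a
falling-*-∸+ a j with j ℕₚ.≤? a
... | yes j≤a = cong (falling a j ℕ.*_) (ℕₚ.m∸n+n≡m j≤a)
... | no  j≰a rewrite falling-< (ℕₚ.≰⇒> j≰a) = refl

falling-self : ∀ a → falling a a ≡ a !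
falling-self zero    = refl
falling-self (suc a) = cong (suc a ℕ.*_) (falling-self a)

evalDMon-self : ∀ {m} (t : Exp m) → evalDMon t t ≡ vecFact t
evalDMon-self []      = refl
evalDMon-self (a ∷ t) = cong₂ ℕ._*_ (falling-self a) (evalDMon-self t)

evalDMon≢0⇒≤ : ∀ {m} (e t : Exp m) → ¬ evalDMon e t ≡ 0 → Pointwise _≤_ e t
evalDMon≢0⇒≤ []      []      _ = []
evalDMon≢0⇒≤ (j ∷ e) (a ∷ t) D≢0 =
  falling≢0⇒≤ (λ F≡0 → D≢0 (cong (ℕ._* evalDMon e t) F≡0)) ∷
  evalDMon≢0⇒≤ e t (λ D′≡0 →
    D≢0 (trans (cong (falling a j ℕ.*_) D′≡0) (ℕₚ.*-zeroʳ (falling a j))))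

degE-mono : ∀ {m} {e t : Exp m} → Pointwise _≤_ e t → degE e ≤ degE t
degE-mono []          = ℕ.z≤n
degE-mono (j≤a ∷ e≤t) = ℕₚ.+-mono-≤ j≤a (degE-mono e≤t)

≤∧degE≡⇒≡ : ∀ {m} {e t : Exp m} → Pointwise _≤_ e t → degE e ≡ degE t → e ≡ t
≤∧degE≡⇒≡ []                                      _  = refl
≤∧degE≡⇒≡ {e = j ∷ e} {t = a ∷ t} (j≤a ∷ e≤t) eq =
  cong₂ _∷_ j≡a
    (≤∧degE≡⇒≡ e≤t (ℕₚ.+-cancelˡ-≡ a _ _ (trans (cong (_+ degE e) (sym j≡a)) eq)))
  where
  j≡a : j ≡ a
  j≡a = ℕₚ.≤-antisym j≤a (ℕₚ.+-cancelʳ-≤ (degE e) a j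
          (ℕₚ.≤-trans (ℕₚ.+-monoʳ-≤ a (degE-mono e≤t)) (ℕₚ.≤-reflexive (sym eq))))

evalDMon-vanishes : ∀ {m} (e t : Exp m) → degE e ≡ degE t → ¬ e ≡ t → evalDMon e t ≡ 0
evalDMon-vanishes e t degE≡ e≢t with evalDMon e t ℕ.≟ 0
... | yes D≡0 = D≡0
... | no  D≢0 = ⊥-elim (e≢t (≤∧degE≡⇒≡ (evalDMon≢0⇒≤ e t D≢0) degE≡))

evalDMon-mulVar : ∀ {m} (i : Fin m) (e t : Exp m) →
  evalDMon (zipWith _+_ (unitE i) e) t ≡ evalDMon e t ℕ.* lookup (zipWith _∸_ t e) i
evalDMon-mulVar fzero    (j ∷ e) (a ∷ t) = begin
  falling a (suc j) ℕ.* evalDMon (zipWith _+_ (tabulate (λ _ → 0)) e) t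
    ≡⟨ cong₂ ℕ._*_ (falling-suc a j) (cong (λ w → evalDMon w t) (zipWith-+-identityˡ e)) ⟩
  falling a j ℕ.* (a ∸ j) ℕ.* evalDMon e t
    ≡⟨ solve 3 (λ F x D → F :* x :* D := F :* D :* x) refl (falling a j) (a ∸ j) (evalDMon e t) ⟩
  falling a j ℕ.* evalDMon e t ℕ.* (a ∸ j) ∎
  where open ≡-Reasoning; open +-*-Solver
evalDMon-mulVar (fsuc i) (j ∷ e) (a ∷ t) =
  trans (cong (falling a j ℕ.*_) (evalDMon-mulVar i e t)) (sym (ℕₚ.*-assoc (falling a j) _ _))

evalDMon-*-degE : ∀ {m} (e t : Exp m) →
  evalDMon e t ℕ.* (degE (zipWith _∸_ t e) + degE e) ≡ evalDMon e t ℕ.* degE t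
evalDMon-*-degE []      []      = refl
evalDMon-*-degE (j ∷ e) (a ∷ t) = begin
  F ℕ.* D ℕ.* ((a ∸ j + V) + (j + E))
    ≡⟨ solve 6 (λ F D x j V E → F :* D :* ((x :+ V) :+ (j :+ E))
                              := F :* (x :+ j) :* D :+ F :* (D :* (V :+ E)))
               refl F D (a ∸ j) j V E ⟩
  F ℕ.* (a ∸ j + j) ℕ.* D + F ℕ.* (D ℕ.* (V + E))
    ≡⟨ cong₂ (λ u v → u ℕ.* D + F ℕ.* v) (falling-*-∸+ a j) (evalDMon-*-degE e t) ⟩
  F ℕ.* a ℕ.* D + F ℕ.* (D ℕ.* degE t)
    ≡⟨ solve 4 (λ F D a T → F :* a :* D :+ F :* (D :* T) := F :* D :* (a :+ T)) refl F D a (degE t) ⟩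
  F ℕ.* D ℕ.* (a + degE t) ∎
  where
  open ≡-Reasoning
  open +-*-Solver
  F = falling a j
  D = evalDMon e t
  V = degE (zipWith _∸_ t e)
  E = degE e

evalDMon-codegree : ∀ {m} (e t : Exp m) s → degE e + s ≡ degE t →
  evalDMon e t ℕ.* degE (zipWith _∸_ t e) ≡ evalDMon e t ℕ.* s
evalDMon-codegree e t s deg≡ = ℕₚ.+-cancelʳ-≡ (D ℕ.* degE e) _ _ (begin
  D ℕ.* degE (zipWith _∸_ t e) + D ℕ.* degE e ≡⟨ sym (ℕₚ.*-distribˡ-+ D _ (degE e)) ⟩
  D ℕ.* (degE (zipWith _∸_ t e) + degE e)     ≡⟨ evalDMon-*-degE e t ⟩
  D ℕ.* degE t                                ≡⟨ cong (D ℕ.*_) (trans (sym deg≡) (ℕₚ.+-comm (degE e) s)) ⟩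
  D ℕ.* (s + degE e)                          ≡⟨ ℕₚ.*-distribˡ-+ D s (degE e) ⟩
  D ℕ.* s + D ℕ.* degE e                      ∎)
  where
  open ≡-Reasoning
  D = evalDMon e t

∑-lookup : ∀ {n} (v : Vec ℕ n) → ∑[ i ∈ allFin n ] ℕ→ℚ (lookup v i) ≡ ℕ→ℚ (degE v)
∑-lookup {zero}  []      = refl
∑-lookup {suc n} (x ∷ v) =
  trans (∑-allFin-suc n (ℕ→ℚ ∘ lookup (x ∷ v)))
        (trans (cong (ℕ→ℚ x ℚ.+_) (∑-lookup v)) (sym (ℕ→ℚ-+ x (degE v))))

HasCodegree : ∀ {m} → Exp m → ℕ → Term m → Set
HasCodegree t s term = ¬ proj₁ term ≡ 0ℚ → degE (proj₂ term) + s ≡ degE t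

degE-zipWith-+ : ∀ {m} (x y : Vec ℕ m) → degE (zipWith _+_ x y) ≡ degE x + degE y
degE-zipWith-+ []       []       = refl
degE-zipWith-+ (x ∷ xs) (y ∷ ys) = trans (cong (λ r → x + y + r) (degE-zipWith-+ xs ys))
  (solve 4 (λ x y X Y → (x :+ y) :+ (X :+ Y) := (x :+ X) :+ (y :+ Y)) refl x y (degE xs) (degE ys))
  where open +-*-Solver

degE-zeros : ∀ m → degE (tabulate {n = m} (λ _ → 0)) ≡ 0
degE-zeros zero    = refl
degE-zeros (suc m) = degE-zeros m

degE-unitE : ∀ {m} (i : Fin m) → degE (unitE i) ≡ 1
degE-unitE {suc m} fzero    = cong suc (degE-zeros m)
degE-unitE {suc m} (fsuc i) = degE-unitE i

HasCodegree-·ₜ : ∀ {m} {t : Exp m} {k s} (a b : Term m) →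
  degE (proj₂ a) ≡ k → HasCodegree t (k + s) b → HasCodegree t s (a ·ₜ b)
HasCodegree-·ₜ {t = t} {k} {s} (ca , ea) (cb , eb) deg-a≡k hb cacb≢0 = begin
  degE (zipWith _+_ ea eb) + s ≡⟨ cong (_+ s) (degE-zipWith-+ ea eb) ⟩
  degE ea + degE eb + s        ≡⟨ cong (λ d → d + degE eb + s) deg-a≡k ⟩
  k + degE eb + s              ≡⟨ solve 3 (λ k E s → k :+ E :+ s := E :+ (k :+ s)) refl k (degE eb) s ⟩
  degE eb + (k + s)            ≡⟨ hb (λ cb≡0 → cacb≢0 (trans (cong (ca *_) cb≡0) (ℚₚ.*-zeroʳ ca))) ⟩
  degE t                       ∎
  where open ≡-Reasoning; open +-*-Solver

All-· : ∀ {m} {P Q R : Term m → Set} {p q : Poly m} →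
  (∀ {a b} → P a → Q b → R (a ·ₜ b)) → All P p → All Q q → All R (p · q)
All-· R-· []         qs = []
All-· R-· (pa ∷ ps) qs = ++⁺ (map⁺ (All.map (R-· pa) qs)) (All-· R-· ps qs)

sumVars-linear : ∀ m → All (λ a → degE (proj₂ a) ≡ 1) (sumVars m)
sumVars-linear m = map⁺ (tabulate⁺ degE-unitE)

sumVars-·-codegree : ∀ {m} (t : Exp m) {s} {f : Poly m} →
  All (HasCodegree t (suc s)) f → All (HasCodegree t s) (sumVars m · f)
sumVars-·-codegree {m} t = All-· (λ {a} {b} → HasCodegree-·ₜ {t = t} a b) (sumVars-linear m)

factorial-coefficient : ∀ {m} (t : Exp m) (term : Term m) →
  HasCodegree t 0 term → ℕ→ℚ (vecFact t) * coefficientOf t term ≡ evalDTerm t term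
factorial-coefficient t (c , e) deg≡ with ≡-dec ℕ._≟_ e t
... | yes refl =
  trans (ℚₚ.*-comm (ℕ→ℚ (vecFact e)) c) (cong (λ n → c * ℕ→ℚ n) (sym (evalDMon-self e)))
... | no  e≢t  = begin
  ℕ→ℚ (vecFact t) * 0ℚ    ≡⟨ ℚₚ.*-zeroʳ (ℕ→ℚ (vecFact t)) ⟩
  0ℚ                      ≡⟨ sym (ℚₚ.*-zeroʳ c) ⟩
  c * 0ℚ                  ≡⟨ *-congˡ-unless-zero (cong ℕ→ℚ ∘ sym ∘ vanishes) ⟩
  c * ℕ→ℚ (evalDMon e t)  ∎
  where
  open ≡-Reasoning
  vanishes : ¬ c ≡ 0ℚ → evalDMon e t ≡ 0
  vanishes c≢0 = evalDMon-vanishes e t (trans (sym (ℕₚ.+-identityʳ (degE e))) (deg≡ c≢0)) e≢t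

coeffDiv≡evalD : ∀ {m} {t : Exp m} {f : Poly m} →
                 All (HasCodegree t 0) f → coeffDiv t f ≡ evalD f t
coeffDiv≡evalD {t = t} {f} hf = begin
  ℕ→ℚ (vecFact t) * coeff t f
    ≡⟨ cong (ℕ→ℚ (vecFact t) *_) (coeff-∑ t f) ⟩
  ℕ→ℚ (vecFact t) * ∑ f (coefficientOf t)
    ≡⟨ ∑-distribˡ (ℕ→ℚ (vecFact t)) f (coefficientOf t) ⟩
  ∑[ x ∈ f ] (ℕ→ℚ (vecFact t) * coefficientOf t x)
    ≡⟨ ∑-congᴬˡˡ hf (λ {x} → factorial-coefficient t x) ⟩
  ∑ f (evalDTerm t)
    ≡⟨ sym (evalD-∑ f t) ⟩
  evalD f t ∎
  where open ≡-Reasoning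

∑-evalDTerm-mulVar : ∀ {m} (t : Exp m) s (term : Term m) → HasCodegree t s term →
  ∑[ i ∈ allFin m ] evalDTerm t ((1ℚ , unitE i) ·ₜ term) ≡ ℕ→ℚ s * evalDTerm t term
∑-evalDTerm-mulVar {m} t s (c , e) deg≡ = begin
  ∑[ i ∈ allFin m ] ((1ℚ * c) * ℕ→ℚ (evalDMon (zipWith _+_ (unitE i) e) t))
    ≡⟨ ∑-cong (allFin m) summand ⟩
  ∑[ i ∈ allFin m ] ((c * ℕ→ℚ D) * ℕ→ℚ (lookup v i))
    ≡⟨ sym (∑-distribˡ (c * ℕ→ℚ D) (allFin m) (ℕ→ℚ ∘ lookup v)) ⟩
  (c * ℕ→ℚ D) * ∑[ i ∈ allFin m ] ℕ→ℚ (lookup v i)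
    ≡⟨ cong ((c * ℕ→ℚ D) *_) (∑-lookup v) ⟩
  (c * ℕ→ℚ D) * ℕ→ℚ (degE v)
    ≡⟨ trans (ℚₚ.*-assoc c (ℕ→ℚ D) (ℕ→ℚ (degE v))) (cong (c *_) (sym (ℕ→ℚ-* D (degE v)))) ⟩
  c * ℕ→ℚ (D ℕ.* degE v)
    ≡⟨ *-congˡ-unless-zero (λ c≢0 → cong ℕ→ℚ (evalDMon-codegree e t s (deg≡ c≢0))) ⟩
  c * ℕ→ℚ (D ℕ.* s)
    ≡⟨ trans (cong (c *_) (ℕ→ℚ-* D s)) (sym (ℚₚ.*-assoc c (ℕ→ℚ D) (ℕ→ℚ s))) ⟩
  (c * ℕ→ℚ D) * ℕ→ℚ s
    ≡⟨ ℚₚ.*-comm (c * ℕ→ℚ D) (ℕ→ℚ s) ⟩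
  ℕ→ℚ s * (c * ℕ→ℚ D) ∎
  where
  open ≡-Reasoning
  D = evalDMon e t
  v = zipWith _∸_ t e
  summand : ∀ i → (1ℚ * c) * ℕ→ℚ (evalDMon (zipWith _+_ (unitE i) e) t)
                  ≡ (c * ℕ→ℚ D) * ℕ→ℚ (lookup v i)
  summand i = begin
    (1ℚ * c) * ℕ→ℚ (evalDMon (zipWith _+_ (unitE i) e) t)
      ≡⟨ cong₂ _*_ (ℚₚ.*-identityˡ c) (cong ℕ→ℚ (evalDMon-mulVar i e t)) ⟩
    c * ℕ→ℚ (D ℕ.* lookup v i)
      ≡⟨ cong (c *_) (ℕ→ℚ-* D (lookup v i)) ⟩
    c * (ℕ→ℚ D * ℕ→ℚ (lookup v i))
      ≡⟨ sym (ℚₚ.*-assoc c (ℕ→ℚ D) (ℕ→ℚ (lookup v i))) ⟩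
    (c * ℕ→ℚ D) * ℕ→ℚ (lookup v i) ∎

evalD-sumVars-· : ∀ {m} (t : Exp m) s (f : Poly m) →
  All (HasCodegree t s) f → evalD (sumVars m · f) t ≡ ℕ→ℚ s * evalD f t
evalD-sumVars-· {m} t s f hf = begin
  evalD (sumVars m · f) t
    ≡⟨ evalD-∑ (sumVars m · f) t ⟩
  ∑ (sumVars m · f) (evalDTerm t)
    ≡⟨ ∑-· (sumVars m) f (evalDTerm t) ⟩
  ∑[ a ∈ sumVars m ] ∑[ b ∈ f ] evalDTerm t (a ·ₜ b)
    ≡⟨ ∑-map var (allFin m) _ ⟩
  ∑[ i ∈ allFin m ] ∑[ b ∈ f ] evalDTerm t (var i ·ₜ b)
    ≡⟨ ∑-comm (allFin m) f _ ⟩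
  ∑[ b ∈ f ] ∑[ i ∈ allFin m ] evalDTerm t (var i ·ₜ b)
    ≡⟨ ∑-congᴬˡˡ hf (λ {b} → ∑-evalDTerm-mulVar t s b) ⟩
  ∑[ b ∈ f ] (ℕ→ℚ s * evalDTerm t b)
    ≡⟨ sym (∑-distribˡ (ℕ→ℚ s) f (evalDTerm t)) ⟩
  ℕ→ℚ s * ∑ f (evalDTerm t)
    ≡⟨ cong (ℕ→ℚ s *_) (sym (evalD-∑ f t)) ⟩
  ℕ→ℚ s * evalD f t ∎
  where
  open ≡-Reasoning
  var : Fin m → Term m
  var i = (1ℚ , unitE i)

mainTheorem2 : (m s : ℕ) (t : Exp m) (f : Poly m)
    → All (λ term → ¬ (proj₁ term ≡ 0ℚ) → degE (proj₂ term) + s ≡ degE t) f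
    → coeffDiv t ((sumVars m ^P s) · f) ≡ ℕ→ℚ (s !) * evalD f t
mainTheorem2 m zero t f hf = begin
  coeffDiv t (oneP · f)  ≡⟨ ∑-cong⇒coeffDiv-cong t (oneP · f) f (∑-oneP-· f) ⟩
  coeffDiv t f           ≡⟨ coeffDiv≡evalD hf ⟩
  evalD f t              ≡⟨ sym (ℚₚ.*-identityˡ (evalD f t)) ⟩
  ℕ→ℚ (0 !) * evalD f t  ∎
  where open ≡-Reasoning
mainTheorem2 m (suc s) t f hf = begin
  coeffDiv t ((X · Xˢ) · f)
    ≡⟨ ∑-cong⇒coeffDiv-cong t ((X · Xˢ) · f) (Xˢ · (X · f)) (∑-·-leftComm X Xˢ f) ⟩
  coeffDiv t (Xˢ · (X · f))
    ≡⟨ mainTheorem2 m s t (X · f) (sumVars-·-codegree t hf) ⟩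
  ℕ→ℚ (s !) * evalD (X · f) t
    ≡⟨ cong (ℕ→ℚ (s !) *_) (evalD-sumVars-· t (suc s) f hf) ⟩
  ℕ→ℚ (s !) * (ℕ→ℚ (suc s) * evalD f t)
    ≡⟨ sym (ℚₚ.*-assoc (ℕ→ℚ (s !)) (ℕ→ℚ (suc s)) (evalD f t)) ⟩
  ℕ→ℚ (s !) * ℕ→ℚ (suc s) * evalD f t
    ≡⟨ cong (_* evalD f t) (ℚₚ.*-comm (ℕ→ℚ (s !)) (ℕ→ℚ (suc s))) ⟩
  ℕ→ℚ (suc s) * ℕ→ℚ (s !) * evalD f t
    ≡⟨ cong (_* evalD f t) (sym (ℕ→ℚ-* (suc s) (s !))) ⟩
  ℕ→ℚ (suc s !) * evalD f t ∎
  where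
  open ≡-Reasoning
  X Xˢ : Poly m
  X  = sumVars m
  Xˢ = X ^P s
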